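{- Let $k\geq 2$, $n\geq 1$ and $1\leq m\leq\min\{k-1,n\}$. Then $$A_1(n,m)=\sum_{j=0}^{m}(-1)^j\binom{m-j}{j}f_k(n-j).$$
   Context: A permutation $\alpha\in S_n$ contains a pattern $\tau\in S_m$ if there are indices $i_1<\dots<i_m$ with $(\alpha_{i_1},\dots,\alpha_{i_m})$ order-isomorphic to $\tau$; otherwise it avoids $\tau$. A permutation is $321$-$k$-gon-avoiding if it avoids $321$ and each of the four patterns $(k,k+2,k+3,\dots,2k-1,1,2k,2,3,\dots,k+1)$, $(k,k+2,k+3,\dots,2k-1,2k,1,2,3,\dots,k+1)$, $(k+1,k+2,k+3,\dots,2k-1,1,2k,2,3,\dots,k)$, $(k+1,k+2,k+3,\dots,2k-1,2k,1,2,3,\dots,k)$. $f_k(n)$ is the number of $321$-$k$-gon-avoiding permutations in $S_n$ ($f_k(0)=1$); $f_k(n;i_1,\dots,i_m)$ is the number of such permutations $\pi\in S_n$ with $\pi_1\cdots\pi_m=i_1\cdots i_m$. For $d,m\geq1$, $A_d(n,m)=\sum_{d\leq i_1<i_2<\cdots<i_m\leq n}f_k(n;i_1,\dots,i_m)$. -}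

module Defs where

open import Data.Nat using (ℕ; zero; suc; _+_; _*_; _∸_; _<ᵇ_; _≡ᵇ_)
open import Data.Nat.Combinatorics using (_C_)
open import Data.Bool using (Bool; true; false; _∧_; not; if_then_else_)
open import Data.List using (List; []; _∷_; _++_; map; length; concatMap; take; upTo; zip; foldr)
open import Data.Product using (_×_; _,_; proj₁; proj₂)
open import Data.Integer as ℤ using (ℤ; +_; -[1+_])
open import Relation.Nullary.Decidable using (does)
open import Relation.Unary using (Pred)
open import Data.List.Relation.Unary.All using (All)

filterᵇ : {A : Set} → (A → Bool) → List A → List A
filterᵇ p []       = []
filterᵇ p (x ∷ xs) = if p x then x ∷ filterᵇ p xs else filterᵇ p xs

allᵇ anyᵇ : {A : Set} → (A → Bool) → List A → Bool
allᵇ p = foldr (λ x b → p x ∧ b) true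
anyᵇ p = foldr (λ x b → p x Data.Bool.∨ b) false

-- Permutations of [n] = {1,…,n} are represented as lists π₁ π₂ ⋯ πₙ (one-line notation).

range : ℕ → ℕ → List ℕ
range a b = map (λ i → a + i) (upTo (suc b ∸ a))

words : ℕ → List ℕ → List (List ℕ)
words zero    xs = [] ∷ []
words (suc l) xs = concatMap (λ x → map (x ∷_) (words l xs)) xs

elemᵇ : ℕ → List ℕ → Bool
elemᵇ x []       = false
elemᵇ x (y ∷ ys) = (x ≡ᵇ y) Data.Bool.∨ elemᵇ x ys

distinctᵇ : List ℕ → Bool
distinctᵇ []       = true
distinctᵇ (x ∷ xs) = not (elemᵇ x xs) ∧ distinctᵇ xs

perms : ℕ → List (List ℕ)
perms n = filterᵇ distinctᵇ (words n (range 1 n))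

subseqs : {A : Set} → ℕ → List A → List (List A)
subseqs zero    xs       = [] ∷ []
subseqs (suc l) []       = []
subseqs (suc l) (x ∷ xs) = map (x ∷_) (subseqs l xs) ++ subseqs (suc l) xs

orderIsoᵇ : List ℕ → List ℕ → Bool
orderIsoᵇ xs ys =
  (length xs ≡ᵇ length ys) ∧
  allᵇ (λ p → allᵇ (λ q → does (Data.Bool._≟_ (proj₁ p <ᵇ proj₁ q) (proj₂ p <ᵇ proj₂ q))) ps) ps
  where ps = zip xs ys

containsᵇ : List ℕ → List ℕ → Bool
containsᵇ α τ = anyᵇ (λ s → orderIsoᵇ s τ) (subseqs (length τ) α)

avoidsᵇ : List ℕ → List ℕ → Bool
avoidsᵇ α τ = not (containsᵇ α τ)

-- In the first two the tail "2,3,…,k+1" must omit k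
-- (k already occurs as the first entry); it is 2,3,…,k-1,k+1 so that the
-- pattern is a permutation of [2k] (for k=2: 2143, 2413, 3142, 3412).
gon₁ gon₂ gon₃ gon₄ : ℕ → List ℕ
gon₁ k = k ∷ range (k + 2) (2 * k ∸ 1) ++ 1 ∷ 2 * k ∷ range 2 (k ∸ 1) ++ (k + 1) ∷ []
gon₂ k = k ∷ range (k + 2) (2 * k ∸ 1) ++ 2 * k ∷ 1 ∷ range 2 (k ∸ 1) ++ (k + 1) ∷ []
gon₃ k = (k + 1) ∷ range (k + 2) (2 * k ∸ 1) ++ 1 ∷ 2 * k ∷ range 2 k
gon₄ k = (k + 1) ∷ range (k + 2) (2 * k ∸ 1) ++ 2 * k ∷ 1 ∷ range 2 k

gonAvoidingᵇ : ℕ → List ℕ → Bool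
gonAvoidingᵇ k π =
  avoidsᵇ π (3 ∷ 2 ∷ 1 ∷ []) ∧ avoidsᵇ π (gon₁ k) ∧ avoidsᵇ π (gon₂ k)
  ∧ avoidsᵇ π (gon₃ k) ∧ avoidsᵇ π (gon₄ k)

count : {A : Set} → (A → Bool) → List A → ℕ
count p xs = length (filterᵇ p xs)

listEqᵇ : List ℕ → List ℕ → Bool
listEqᵇ []       []       = true
listEqᵇ (x ∷ xs) (y ∷ ys) = (x ≡ᵇ y) ∧ listEqᵇ xs ys
listEqᵇ _        _        = false

f : ℕ → ℕ → ℕ
f k n = count (gonAvoidingᵇ k) (perms n)

fPre : ℕ → ℕ → List ℕ → ℕ
fPre k n is = count (λ π → gonAvoidingᵇ k π ∧ listEqᵇ (take (length is) π) is) (perms n)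

-- A_d(n,m) = Σ_{d ≤ i₁ < ⋯ < i_m ≤ n} f_k(n; i₁,…,i_m)
-- (strictly increasing m-tuples in [d..n] = length-m subsequences of the list d,d+1,…,n)
A : ℕ → ℕ → ℕ → ℕ → ℕ
A k d n m = foldr _+_ 0 (map (fPre k n) (subseqs m (range d n)))

sumℤ : List ℤ → ℤ
sumℤ = foldr ℤ._+_ (+ 0)

rhs : ℕ → ℕ → ℕ → ℤ
rhs k n m = sumℤ (map (λ j → (ℤ.-1ℤ ℤ.^ j) ℤ.* (+ (((m ∸ j) C j) * f k (n ∸ j)))) (upTo (suc m)))

-- An avoider is counted in A₁(n,m) exactly when its first m entries increase, and then only
-- for the tuple they form; so A₁(n,m) = fAsc(n,m), the number of avoiders in S_n whose first
-- m entries increase.  Classify such π ∈ S_{n+1} by where the entry 1 sits.  If π₁ = 1,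
-- deleting it (and lowering the other entries) leaves an avoider whose first i entries
-- increase.  Otherwise 321-avoidance forces π_{i+2} to be 1 or to exceed π_{i+1}.  Deleting an
-- entry 1 that sits at position at most k - 1 right after an increasing prefix changes neither
-- 321- nor k-gon-avoidance, because every k-gon pattern has at least k - 1 entries, all ≥ 2,
-- in front of its own 1.  Hence fAsc(n+1,i+1) = fAsc(n,i) + fAsc(n+1,i+2) when
-- i + 2 ≤ min(k-1, n+1), and fAsc(n,0) = fAsc(n,1) = f_k(n).  Pascal's rule for C(m-j, j)
-- shows that the alternating sum obeys the same recurrence with the same initial values.

module Submission where

open import Defs

module AlternatingSum where

  open import Data.Nat as ℕ using (ℕ; zero; suc; _∸_; _≤_; _<_; z≤n; s≤s)
  import Data.Nat.Properties as ℕ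
  open import Data.Nat.Combinatorics using (_C_; nCk+nC[k+1]≡[n+1]C[k+1]; k>n⇒nCk≡0)
  open import Data.Integer using (ℤ; +_; 0ℤ; -1ℤ; _+_; _-_; -_; _*_; _^_)
  open import Data.Integer.Properties using (+-identityʳ; +-comm; +-assoc; *-zeroʳ; *-identityˡ; pos-+)
  open import Data.Integer.Tactic.RingSolver using (solve-∀)
  open import Data.List using (map; applyUpTo)
  open import Data.Sum using (inj₁; inj₂)
  open import Function using (_∘_; id)
  open import Relation.Binary.PropositionalEquality

  ∑ : ℕ → (ℕ → ℤ) → ℤ
  ∑ zero    h = 0ℤ
  ∑ (suc N) h = h 0 + ∑ N (h ∘ suc)

  sumℤ-applyUpTo : ∀ N (g : ℕ → ℕ) (h : ℕ → ℤ) → sumℤ (map h (applyUpTo g N)) ≡ ∑ N (h ∘ g)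
  sumℤ-applyUpTo zero    g h = refl
  sumℤ-applyUpTo (suc N) g h = cong (λ s → h (g 0) + s) (sumℤ-applyUpTo N (g ∘ suc) h)

  ∑-snoc : ∀ N h → ∑ (suc N) h ≡ ∑ N h + h N
  ∑-snoc zero    h = +-comm (h 0) 0ℤ
  ∑-snoc (suc N) h = trans (cong (λ s → h 0 + s) (∑-snoc N (h ∘ suc))) (sym (+-assoc (h 0) _ _))

  ∑-cong : ∀ N {g h} → (∀ j → g j ≡ h j) → ∑ N g ≡ ∑ N h
  ∑-cong zero    _   = refl
  ∑-cong (suc N) g≡h = cong₂ _+_ (g≡h 0) (∑-cong N (g≡h ∘ suc))

  ∑-distrib-- : ∀ N g h → ∑ N (λ j → g j - h j) ≡ ∑ N g - ∑ N h
  ∑-distrib-- zero    g h = refl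
  ∑-distrib-- (suc N) g h =
    trans (cong (λ s → g 0 - h 0 + s) (∑-distrib-- N (g ∘ suc) (h ∘ suc))) (interchange (g 0) (h 0) _ _)
    where
    interchange : ∀ a b c d → (a - b) + (c - d) ≡ (a + c) - (b + d)
    interchange = solve-∀

  pascal-∸ : ∀ m j → (suc m ∸ j) C suc j ≡ (m ∸ j) C suc j ℕ.+ (m ∸ j) C j
  pascal-∸ m j with ℕ.≤-<-connex j m
  ... | inj₁ j≤m rewrite ℕ.+-∸-assoc 1 j≤m =
    trans (sym (nCk+nC[k+1]≡[n+1]C[k+1] (m ∸ j) j)) (ℕ.+-comm ((m ∸ j) C j) _)
  ... | inj₂ m<j rewrite ℕ.m≤n⇒m∸n≡0 m<j | ℕ.m≤n⇒m∸n≡0 (ℕ.<⇒≤ m<j) =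
    sym (cong₂ ℕ._+_ (k>n⇒nCk≡0 {0} {suc j} (s≤s z≤n)) (k>n⇒nCk≡0 (ℕ.≤-trans (s≤s z≤n) m<j)))

  module _ (F : ℕ → ℕ) where

    term : ℕ → ℕ → ℕ → ℤ
    term m n j = (-1ℤ ^ j) * (+ (((m ∸ j) C j) ℕ.* F (n ∸ j)))

    term-zero : ∀ m n → term m n 0 ≡ + F n
    term-zero m n = trans (*-identityˡ (+ (F n ℕ.+ 0))) (cong +_ (ℕ.+-identityʳ (F n)))

    term-vanishes : ∀ {m j} n → m < j → term m n j ≡ 0ℤ
    term-vanishes {m} {j} n m<j = begin
      (-1ℤ ^ j) * (+ (((m ∸ j) C j) ℕ.* F (n ∸ j)))
        ≡⟨ cong (λ i → (-1ℤ ^ j) * (+ ((i C j) ℕ.* F (n ∸ j)))) (ℕ.m≤n⇒m∸n≡0 (ℕ.<⇒≤ m<j)) ⟩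
      (-1ℤ ^ j) * (+ ((0 C j) ℕ.* F (n ∸ j)))
        ≡⟨ cong (λ c → (-1ℤ ^ j) * (+ (c ℕ.* F (n ∸ j)))) (k>n⇒nCk≡0 (ℕ.≤-trans (s≤s z≤n) m<j)) ⟩
      (-1ℤ ^ j) * 0ℤ
        ≡⟨ *-zeroʳ (-1ℤ ^ j) ⟩
      0ℤ
        ∎
      where open ≡-Reasoning

    ∑-term-pad : ∀ {m N} n → m < N → ∑ N (term m n) ≡ ∑ (suc m) (term m n)
    ∑-term-pad {m} {suc N} n m<N with ℕ.m<1+n⇒m<n∨m≡n m<N
    ... | inj₂ refl = refl
    ... | inj₁ m<N′ = begin
      ∑ (suc N) (term m n)        ≡⟨ ∑-snoc N (term m n) ⟩
      ∑ N (term m n) + term m n N ≡⟨ cong₂ _+_ (∑-term-pad n m<N′) (term-vanishes n m<N′) ⟩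
      ∑ (suc m) (term m n) + 0ℤ   ≡⟨ +-identityʳ _ ⟩
      ∑ (suc m) (term m n)        ∎
      where open ≡-Reasoning

    term-pascal : ∀ m n j → term (suc (suc m)) (suc n) (suc j) ≡ term (suc m) (suc n) (suc j) - term m n j
    term-pascal m n j = begin
      (-1ℤ * s) * (+ (((suc m ∸ j) C suc j) ℕ.* F (n ∸ j)))
        ≡⟨ cong (λ c → (-1ℤ * s) * (+ (c ℕ.* F (n ∸ j)))) (pascal-∸ m j) ⟩
      (-1ℤ * s) * (+ ((a ℕ.+ b) ℕ.* F (n ∸ j)))
        ≡⟨ cong (λ x → (-1ℤ * s) * (+ x)) (ℕ.*-distribʳ-+ (F (n ∸ j)) a b) ⟩
      (-1ℤ * s) * (+ (a ℕ.* F (n ∸ j) ℕ.+ b ℕ.* F (n ∸ j)))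
        ≡⟨ cong ((-1ℤ * s) *_) (pos-+ (a ℕ.* F (n ∸ j)) _) ⟩
      (-1ℤ * s) * (+ (a ℕ.* F (n ∸ j)) + + (b ℕ.* F (n ∸ j)))
        ≡⟨ split s _ _ ⟩
      (-1ℤ * s) * (+ (a ℕ.* F (n ∸ j))) - s * (+ (b ℕ.* F (n ∸ j)))
        ∎
      where
      open ≡-Reasoning
      s = -1ℤ ^ j
      a = (m ∸ j) C suc j
      b = (m ∸ j) C j
      split : ∀ s x y → (-1ℤ * s) * (x + y) ≡ (-1ℤ * s) * x - s * y
      split = solve-∀

    ∑-term-recurrence : ∀ m n N →
      ∑ (suc N) (term (suc (suc m)) (suc n)) ≡ ∑ (suc N) (term (suc m) (suc n)) - ∑ N (term m n)
    ∑-term-recurrence m n N = begin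
      term (suc (suc m)) (suc n) 0 + ∑ N (term (suc (suc m)) (suc n) ∘ suc)
        ≡⟨ cong₂ _+_ (term-zero (suc (suc m)) (suc n)) (∑-cong N (term-pascal m n)) ⟩
      + F (suc n) + ∑ N (λ j → term (suc m) (suc n) (suc j) - term m n j)
        ≡⟨ cong (λ x → + F (suc n) + x) (∑-distrib-- N _ _) ⟩
      + F (suc n) + (∑ N (term (suc m) (suc n) ∘ suc) - ∑ N (term m n))
        ≡⟨ +-assoc (+ F (suc n)) (∑ N (term (suc m) (suc n) ∘ suc)) (- ∑ N (term m n)) ⟨
      + F (suc n) + ∑ N (term (suc m) (suc n) ∘ suc) - ∑ N (term m n)
        ≡⟨ cong (λ x → x + ∑ N (term (suc m) (suc n) ∘ suc) - ∑ N (term m n)) (term-zero (suc m) (suc n)) ⟨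
      ∑ (suc N) (term (suc m) (suc n)) - ∑ N (term m n)
        ∎
      where open ≡-Reasoning

  rhs≡∑ : ∀ k n m → rhs k n m ≡ ∑ (suc m) (term (f k) m n)
  rhs≡∑ k n m = sumℤ-applyUpTo (suc m) id (term (f k) m n)

  rhs-≤1 : ∀ k n m → m ≤ 1 → rhs k n m ≡ + f k n
  rhs-≤1 k n zero          _ = trans (+-identityʳ _) (term-zero (f k) 0 n)
  rhs-≤1 k n (suc zero)    _ = trans (+-identityʳ _) (term-zero (f k) 1 n)
  rhs-≤1 k n (suc (suc _)) (s≤s ())

  rhs-recurrence : ∀ k n m → rhs k (suc n) (suc (suc m)) ≡ rhs k (suc n) (suc m) - rhs k n m
  rhs-recurrence k n m = begin
    rhs k (suc n) (2 ℕ.+ m)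
      ≡⟨ rhs≡∑ k (suc n) (2 ℕ.+ m) ⟩
    ∑ (3 ℕ.+ m) (term (f k) (2 ℕ.+ m) (suc n))
      ≡⟨ ∑-term-recurrence (f k) m n (2 ℕ.+ m) ⟩
    ∑ (3 ℕ.+ m) (term (f k) (suc m) (suc n)) - ∑ (2 ℕ.+ m) (term (f k) m n)
      ≡⟨ cong₂ _-_ (∑-term-pad (f k) (suc n) (ℕ.m<n⇒m<1+n (ℕ.n<1+n (suc m))))
                   (∑-term-pad (f k) n (ℕ.m<n⇒m<1+n (ℕ.n<1+n m))) ⟩
    ∑ (2 ℕ.+ m) (term (f k) (suc m) (suc n)) - ∑ (suc m) (term (f k) m n)
      ≡⟨ cong₂ _-_ (rhs≡∑ k (suc n) (suc m)) (rhs≡∑ k n m) ⟨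
    rhs k (suc n) (suc m) - rhs k n m
      ∎
    where open ≡-Reasoning

  a≡b+c⇒+c≡+a-+b : ∀ {a b c} → a ≡ b ℕ.+ c → + c ≡ + a - + b
  a≡b+c⇒+c≡+a-+b {b = b} {c} refl = trans (cancel (+ b) (+ c)) (cong (_- + b) (sym (pos-+ b c)))
    where
    cancel : ∀ x y → y ≡ x + y - x
    cancel = solve-∀

open AlternatingSum using (rhs-≤1; rhs-recurrence; a≡b+c⇒+c≡+a-+b)

open import Relation.Binary.PropositionalEquality
open import Data.Bool using (Bool; true; false; T; _∧_; _∨_; not)
import Data.Bool as Bool
open import Data.Bool.ListAction using (any; all)
open import Data.Bool.Properties using (T-∧; T-∨; T-≡; ∧-identityʳ; ∧-zeroʳ; ∧-assoc)
open import Data.Empty using (⊥; ⊥-elim)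
open import Data.List
  using (List; []; _∷_; _++_; map; length; take; drop; filter; upTo; zip; cartesianProductWith; concatMap)
open import Data.List.Membership.Propositional using (_∈_; find; lose)
open import Data.List.Membership.Propositional.Properties
  using ( ∈-∃++; ∈-++⁻; ∈-++⁺ˡ; ∈-++⁺ʳ; ∈-filter⁻; ∈-filter⁺; ∈-map⁻; ∈-map⁺; ∈-upTo⁻; ∈-upTo⁺
        ; ∈-cartesianProductWith⁻; ∈-cartesianProductWith⁺)
open import Data.List.Membership.Propositional.Properties.WithK using (unique∧set⇒bag)
open import Data.List.Properties
  using ( ++-assoc; ∷-injective; ∷-injectiveʳ; length-++; length-map; length-upTo; length-++-sucʳ; length-take
        ; map-∘; map-id-local; map-injective; take++drop≡id; take-map)
open import Data.List.Relation.Binary.BagAndSetEquality using (∼bag⇒↭)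
open import Data.List.Relation.Binary.Permutation.Propositional.Properties using (↭-length)
open import Data.List.Relation.Binary.Sublist.Propositional
  using (_⊆_; []; _∷_; _∷ʳ_; minimum; from∈; ⊆-refl; ⊆-trans)
open import Data.List.Relation.Binary.Sublist.Propositional.Properties
  using (map⁺; ++⁺; ++⁺ˡ; All-resp-⊆; Any-resp-⊆; length-mono-≤)
open import Data.List.Relation.Unary.All using (All; []; _∷_)
import Data.List.Relation.Unary.All as All
open import Data.List.Relation.Unary.All.Properties using (¬Any⇒All¬; All¬⇒¬Any; all⁺; all⁻)
import Data.List.Relation.Unary.All.Properties as All
open import Data.List.Relation.Unary.AllPairs using (AllPairs; []; _∷_)
import Data.List.Relation.Unary.AllPairs as AllPairs
import Data.List.Relation.Unary.AllPairs.Properties as AllPairs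
open import Data.List.Relation.Unary.Any using (Any; here; there)
open import Data.List.Relation.Unary.Any.Properties using (any⁺; any⁻)
open import Data.List.Relation.Unary.Unique.Propositional using (Unique)
import Data.List.Relation.Unary.Unique.Propositional.Properties as Unique
open import Data.Nat using (ℕ; zero; suc; pred; _+_; _*_; _∸_; _⊓_; _≤_; _<_; _≡ᵇ_; _<ᵇ_; z≤n; s≤s; s≤s⁻¹)
open import Data.Nat.ListAction using (sum)
open import Data.Nat.Properties
open import Algebra.Properties.CommutativeSemigroup +-commutativeSemigroup using (interchange)
open import Data.List.Membership.DecPropositional _≟_ using (_∈?_)
open import Data.List.Relation.Binary.Permutation.Setoid (setoid ℕ) using (↭-sym)
open import Data.List.Relation.Binary.Permutation.Setoid.Properties (setoid ℕ)
  using (↭-shift; Unique-resp-↭; All-resp-↭; ∈-resp-↭)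
open import Data.Product using (∃; _×_; _,_; proj₁; proj₂; map₁)
open import Data.Sum using (_⊎_; inj₁; inj₂)
import Data.Sum
open import Function using (_∘_; id; _⟨_⟩_; _⇔_; mk⇔; Equivalence)
open import Relation.Binary.Definitions using (tri<; tri≈; tri>)
open import Relation.Nullary using (¬_; yes; no)
open import Relation.Nullary.Decidable using (T?; does)

private variable
  X : Set

indicator : Bool → ℕ
indicator true  = 1
indicator false = 0

T⇔T⇒≡ : {a b : Bool} → T a ⇔ T b → a ≡ b
T⇔T⇒≡ {false} {false} _ = refl
T⇔T⇒≡ {false} {true}  h = ⊥-elim (Equivalence.from h _)
T⇔T⇒≡ {true}  {false} h = ⊥-elim (Equivalence.to h _)
T⇔T⇒≡ {true}  {true}  _ = refl

T-≡ᵇ : {m n : ℕ} → T (m ≡ᵇ n) ⇔ m ≡ n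
T-≡ᵇ {m} {n} = mk⇔ (≡ᵇ⇒≡ m n) (≡⇒≡ᵇ m n)

T-≟ : {a b : Bool} → T (does (a Bool.≟ b)) ⇔ a ≡ b
T-≟ {false} {false} = mk⇔ (λ _ → refl) _
T-≟ {false} {true}  = mk⇔ (λ ()) (λ ())
T-≟ {true}  {false} = mk⇔ (λ ()) (λ ())
T-≟ {true}  {true}  = mk⇔ (λ _ → refl) _

≤⇒≮ᵇ : ∀ {m n} → n ≤ m → (m <ᵇ n) ≡ false
≤⇒≮ᵇ {m} {n} n≤m with m <ᵇ n in eq
... | false = refl
... | true  = ⊥-elim (<⇒≱ (<ᵇ⇒< m n (subst T (sym eq) _)) n≤m)

filterᵇ≡filter : (p : X → Bool) (xs : List X) → filterᵇ p xs ≡ filter (T? ∘ p) xs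
filterᵇ≡filter p []       = refl
filterᵇ≡filter p (x ∷ xs) with p x
... | true  = cong (x ∷_) (filterᵇ≡filter p xs)
... | false = filterᵇ≡filter p xs

∈-filterᵇ⁻ : (p : X → Bool) {xs : List X} {x : X} → x ∈ filterᵇ p xs → x ∈ xs × T (p x)
∈-filterᵇ⁻ p {xs} x∈ = ∈-filter⁻ (T? ∘ p) (subst (_ ∈_) (filterᵇ≡filter p xs) x∈)

∈-filterᵇ⁺ : (p : X → Bool) {xs : List X} {x : X} → x ∈ xs → T (p x) → x ∈ filterᵇ p xs
∈-filterᵇ⁺ p {xs} x∈ px = subst (_ ∈_) (sym (filterᵇ≡filter p xs)) (∈-filter⁺ (T? ∘ p) x∈ px)

Unique-filterᵇ : (p : X → Bool) {xs : List X} → Unique xs → Unique (filterᵇ p xs)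
Unique-filterᵇ p {xs} u = subst Unique (sym (filterᵇ≡filter p xs)) (Unique.filter⁺ (T? ∘ p) u)

T-anyᵇ : (p : X → Bool) (xs : List X) → T (anyᵇ p xs) ⇔ Any (T ∘ p) xs
T-anyᵇ p xs = subst (λ b → T b ⇔ Any (T ∘ p) xs) (sym (anyᵇ≡any xs)) (mk⇔ (any⁻ p xs) (any⁺ p))
  where
  anyᵇ≡any : (xs : List _) → anyᵇ p xs ≡ any p xs
  anyᵇ≡any []       = refl
  anyᵇ≡any (x ∷ xs) = cong (p x ∨_) (anyᵇ≡any xs)

T-allᵇ : (p : X → Bool) (xs : List X) → T (allᵇ p xs) ⇔ All (T ∘ p) xs
T-allᵇ p xs = subst (λ b → T b ⇔ All (T ∘ p) xs) (sym (allᵇ≡all xs)) (mk⇔ (all⁺ p xs) (all⁻ p))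
  where
  allᵇ≡all : (xs : List _) → allᵇ p xs ≡ all p xs
  allᵇ≡all []       = refl
  allᵇ≡all (x ∷ xs) = cong (p x ∧_) (allᵇ≡all xs)

T-elemᵇ : {x : ℕ} (xs : List ℕ) → T (elemᵇ x xs) ⇔ x ∈ xs
T-elemᵇ []       = mk⇔ (λ ()) (λ ())
T-elemᵇ (y ∷ ys) = mk⇔ to from
  where
  to : T (elemᵇ _ (y ∷ ys)) → _ ∈ y ∷ ys
  to h with Equivalence.to T-∨ h
  ... | inj₁ x≡y = here (Equivalence.to T-≡ᵇ x≡y)
  ... | inj₂ x∈ = there (Equivalence.to (T-elemᵇ ys) x∈)
  from : _ ∈ y ∷ ys → T (elemᵇ _ (y ∷ ys))
  from (here x≡y) = Equivalence.from T-∨ (inj₁ (Equivalence.from T-≡ᵇ x≡y))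
  from (there x∈) = Equivalence.from T-∨ (inj₂ (Equivalence.from (T-elemᵇ ys) x∈))

T-distinctᵇ : (xs : List ℕ) → T (distinctᵇ xs) ⇔ Unique xs
T-distinctᵇ []       = mk⇔ (λ _ → []) (λ _ → _)
T-distinctᵇ (x ∷ xs) = mk⇔ to from
  where
  to : T (distinctᵇ (x ∷ xs)) → Unique (x ∷ xs)
  to h with elemᵇ x xs in e
  ... | false = ¬Any⇒All¬ xs (λ x∈ → subst T e (Equivalence.from (T-elemᵇ xs) x∈))
                ∷ Equivalence.to (T-distinctᵇ xs) h
  from : Unique (x ∷ xs) → T (distinctᵇ (x ∷ xs))
  from (x∉ ∷ u) with elemᵇ x xs in e
  ... | false = Equivalence.from (T-distinctᵇ xs) u
  ... | true  = All¬⇒¬Any x∉ (Equivalence.to (T-elemᵇ xs) (subst T (sym e) _))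

sum-map-+ : (g h : X → ℕ) (xs : List X) →
            sum (map (λ x → g x + h x) xs) ≡ sum (map g xs) + sum (map h xs)
sum-map-+ g h []       = refl
sum-map-+ g h (x ∷ xs) =
  trans (cong (g x + h x +_) (sum-map-+ g h xs)) (interchange (g x) (h x) _ _)

sum-map-cong : {g h : X → ℕ} {xs : List X} → (∀ {x} → x ∈ xs → g x ≡ h x) →
               sum (map g xs) ≡ sum (map h xs)
sum-map-cong {xs = []}     _   = refl
sum-map-cong {xs = x ∷ xs} g≡h = cong₂ _+_ (g≡h (here refl)) (sum-map-cong (g≡h ∘ there))

sum-map-zero : (xs : List X) → sum (map (λ _ → 0) xs) ≡ 0
sum-map-zero []       = refl
sum-map-zero (_ ∷ xs) = sum-map-zero xs

sum-map-swap : {Y : Set} (h : X → Y → ℕ) (xs : List X) (ys : List Y) →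
  sum (map (λ x → sum (map (h x) ys)) xs) ≡ sum (map (λ y → sum (map (λ x → h x y) xs)) ys)
sum-map-swap h []       ys = sym (sum-map-zero ys)
sum-map-swap h (x ∷ xs) ys =
  trans (cong (sum (map (h x) ys) +_) (sum-map-swap h xs ys)) (sym (sum-map-+ (h x) _ ys))

count≡sum : (p : X → Bool) (xs : List X) → count p xs ≡ sum (map (indicator ∘ p) xs)
count≡sum p []       = refl
count≡sum p (x ∷ xs) with p x
... | true  = cong suc (count≡sum p xs)
... | false = count≡sum p xs

count-cong : {p q : X → Bool} {xs : List X} → (∀ {x} → x ∈ xs → p x ≡ q x) → count p xs ≡ count q xs
count-cong {p = p} {q} {xs} p≡q = begin
  count p xs                     ≡⟨ count≡sum p xs ⟩
  sum (map (indicator ∘ p) xs)   ≡⟨ sum-map-cong (cong indicator ∘ p≡q) ⟩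
  sum (map (indicator ∘ q) xs)   ≡⟨ count≡sum q xs ⟨
  count q xs                     ∎
  where open ≡-Reasoning

count-split : {p q r : X → Bool} {xs : List X} →
  (∀ {x} → x ∈ xs → indicator (p x) ≡ indicator (q x) + indicator (r x)) →
  count p xs ≡ count q xs + count r xs
count-split {p = p} {q} {r} {xs} split = begin
  count p xs                                                  ≡⟨ count≡sum p xs ⟩
  sum (map (indicator ∘ p) xs)                                ≡⟨ sum-map-cong split ⟩
  sum (map (λ x → indicator (q x) + indicator (r x)) xs)      ≡⟨ sum-map-+ (indicator ∘ q) (indicator ∘ r) xs ⟩
  sum (map (indicator ∘ q) xs) + sum (map (indicator ∘ r) xs) ≡⟨ cong₂ _+_ (count≡sum q xs) (count≡sum r xs) ⟨
  count q xs + count r xs                                     ∎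
  where open ≡-Reasoning

count-++ : (p : X → Bool) (xs ys : List X) → count p (xs ++ ys) ≡ count p xs + count p ys
count-++ p []       ys = refl
count-++ p (x ∷ xs) ys with p x
... | true  = cong suc (count-++ p xs ys)
... | false = count-++ p xs ys

count-map : {Y : Set} (p : Y → Bool) (g : X → Y) (xs : List X) → count p (map g xs) ≡ count (p ∘ g) xs
count-map p g []       = refl
count-map p g (x ∷ xs) with p (g x)
... | true  = cong suc (count-map p g xs)
... | false = count-map p g xs

count-false : (xs : List X) → count (λ _ → false) xs ≡ 0
count-false []       = refl
count-false (_ ∷ xs) = count-false xs

∈-range⁻ : ∀ a b {x} → x ∈ range a b → a ≤ x × x ≤ b
∈-range⁻ a b x∈ with ∈-map⁻ (a +_) x∈
... | i , i∈ , refl = m≤m+n a i , ≤-pred (begin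
  suc (a + i)  ≡⟨ cong suc (+-comm a i) ⟩
  suc i + a    ≤⟨ m≤o∸n⇒m+n≤o (suc i) (<⇒≤ a<1+b) i< ⟩
  suc b        ∎)
  where
  open ≤-Reasoning
  i< : i < suc b ∸ a
  i< = ∈-upTo⁻ i∈
  a<1+b : a < suc b
  a<1+b = m∸n≢0⇒n<m (λ eq → n≮0 (subst (i <_) eq i<))

∈-range⁺ : ∀ a b {x} → a ≤ x → x ≤ b → x ∈ range a b
∈-range⁺ a b {x} a≤x x≤b =
  subst (_∈ range a b) (m+[n∸m]≡n a≤x) (∈-map⁺ (a +_) (∈-upTo⁺ (∸-monoˡ-< (s≤s x≤b) a≤x)))

length-range : ∀ a b → length (range a b) ≡ suc b ∸ a
length-range a b = trans (length-map (a +_) (upTo (suc b ∸ a))) (length-upTo _)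

Unique-range : ∀ a b → Unique (range a b)
Unique-range a b = Unique.map⁺ (+-cancelˡ-≡ a _ _) (Unique.upTo⁺ _)

range-ascending : ∀ a b → AllPairs _<_ (range a b)
range-ascending a b = AllPairs.map⁺ (AllPairs.applyUpTo⁺₁ id (suc b ∸ a) (λ i<j _ → +-monoʳ-< a i<j))

words-suc : ∀ l L → words (suc l) L ≡ cartesianProductWith _∷_ L (words l L)
words-suc l L = go L
  where
  go : ∀ M → concatMap (λ x → map (x ∷_) (words l L)) M ≡ cartesianProductWith _∷_ M (words l L)
  go []      = refl
  go (x ∷ M) = cong (map (x ∷_) (words l L) ++_) (go M)

∈-words⁻ : ∀ l L {w} → w ∈ words l L → length w ≡ l × All (_∈ L) w
∈-words⁻ zero    L (here refl) = refl , []
∈-words⁻ (suc l) L w∈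
  with ∈-cartesianProductWith⁻ _∷_ L (words l L) (subst (_ ∈_) (words-suc l L) w∈)
... | x , w , x∈ , w∈′ , refl = let len , all∈ = ∈-words⁻ l L w∈′ in cong suc len , x∈ ∷ all∈

∈-words⁺ : ∀ l L {w} → length w ≡ l → All (_∈ L) w → w ∈ words l L
∈-words⁺ zero    L {[]}    _   []         = here refl
∈-words⁺ (suc l) L {x ∷ w} len (x∈ ∷ all∈) =
  subst (_ ∈_) (sym (words-suc l L)) (∈-cartesianProductWith⁺ _∷_ x∈ (∈-words⁺ l L (suc-injective len) all∈))

Unique-words : ∀ l {L} → Unique L → Unique (words l L)
Unique-words zero    u = [] ∷ []
Unique-words (suc l) {L} u = subst Unique (sym (words-suc l L))
  (Unique.cartesianProductWith⁺ _∷_ (λ { refl → refl , refl }) u (Unique-words l u))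

InRange : ℕ → ℕ → Set
InRange n x = 1 ≤ x × x ≤ n

record IsPermutation (n : ℕ) (π : List ℕ) : Set where
  constructor isPermutation
  field
    length≡ : length π ≡ n
    unique  : Unique π
    entries : All (InRange n) π

∈-perms⁻ : ∀ n {π} → π ∈ perms n → IsPermutation n π
∈-perms⁻ n π∈ =
  let π∈words , distinct = ∈-filterᵇ⁻ distinctᵇ π∈
      len , all∈ = ∈-words⁻ n (range 1 n) π∈words
  in isPermutation len (Equivalence.to (T-distinctᵇ _) distinct) (All.map (∈-range⁻ 1 n) all∈)

∈-perms⁺ : ∀ n {π} → IsPermutation n π → π ∈ perms n
∈-perms⁺ n (isPermutation len u entries) = ∈-filterᵇ⁺ distinctᵇ
  (∈-words⁺ n (range 1 n) len (All.map (λ (1≤x , x≤n) → ∈-range⁺ 1 n 1≤x x≤n) entries))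
  (Equivalence.from (T-distinctᵇ _) u)

≤-length-perm : ∀ {n π j} → π ∈ perms n → j ≤ n → j ≤ length π
≤-length-perm {n} π∈ = subst (_ ≤_) (sym (IsPermutation.length≡ (∈-perms⁻ n π∈)))

Unique-perms : ∀ n → Unique (perms n)
Unique-perms n = Unique-filterᵇ distinctᵇ (Unique-words n (Unique-range 1 n))

Unique-shift : ∀ a {b : List ℕ} {x} → Unique (a ++ x ∷ b) ⇔ Unique (x ∷ a ++ b)
Unique-shift a = mk⇔ (Unique-resp-↭ (↭-shift a _)) (Unique-resp-↭ (↭-sym (↭-shift a _)))

All-shift : ∀ {P : ℕ → Set} a {b : List ℕ} {x} → All P (a ++ x ∷ b) ⇔ All P (x ∷ a ++ b)
All-shift {P} a = mk⇔ (All-resp-↭ (subst P) (↭-shift a _)) (All-resp-↭ (subst P) (↭-sym (↭-shift a _)))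

∈-shift : ∀ a {b : List ℕ} {x y} → y ∈ a ++ x ∷ b ⇔ y ∈ x ∷ a ++ b
∈-shift a = mk⇔ (∈-resp-↭ (↭-shift a _)) (∈-resp-↭ (↭-sym (↭-shift a _)))

∈-remove : ∀ (c : List ℕ) {d x y} → y ∈ c ++ x ∷ d → x ≢ y → y ∈ c ++ d
∈-remove c y∈ x≢y with Equivalence.to (∈-shift c) y∈
... | here y≡x   = ⊥-elim (x≢y (sym y≡x))
... | there y∈′ = y∈′

unique⇒length≤ : {xs ys : List ℕ} → Unique xs → All (_∈ ys) xs → length xs ≤ length ys
unique⇒length≤ {xs = []}     _           _            = z≤n
unique⇒length≤ {xs = x ∷ xs} (x∉xs ∷ u) (x∈ys ∷ xs⊆) with ∈-∃++ x∈ys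
... | c , d , refl = begin
  suc (length xs)        ≤⟨ s≤s (unique⇒length≤ u (All.zipWith remove (x∉xs , xs⊆))) ⟩
  suc (length (c ++ d))  ≡⟨ length-++-sucʳ c x d ⟨
  length (c ++ x ∷ d)    ∎
  where
  open ≤-Reasoning
  remove : ∀ {y} → x ≢ y × y ∈ c ++ x ∷ d → y ∈ c ++ d
  remove (x≢y , y∈) = ∈-remove c y∈ x≢y

1∈perm : ∀ {n π} → IsPermutation (suc n) π → 1 ∈ π
1∈perm {n} {π} (isPermutation len u entries) with 1 ∈? π
... | yes 1∈π = 1∈π
... | no  1∉π = ⊥-elim (<-irrefl refl (begin-strict
  n                          <⟨ n<1+n n ⟩
  suc n                      ≡⟨ len ⟨
  length π                   ≤⟨ unique⇒length≤ u (All.zipWith entry∈ (entries , ¬Any⇒All¬ π 1∉π)) ⟩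
  length (range 2 (suc n))   ≡⟨ length-range 2 (suc n) ⟩
  n                          ∎))
  where
  open ≤-Reasoning
  entry∈ : ∀ {x} → InRange (suc n) x × 1 ≢ x → x ∈ range 2 (suc n)
  entry∈ ((1≤x , x≤n+1) , 1≢x) = ∈-range⁺ 2 (suc n) (≤∧≢⇒< 1≤x 1≢x) x≤n+1

∈-subseqs⁻ : ∀ l (xs : List X) {s} → s ∈ subseqs l xs → s ⊆ xs × length s ≡ l
∈-subseqs⁻ zero    xs       (here refl) = minimum xs , refl
∈-subseqs⁻ (suc l) (x ∷ xs) s∈ with ∈-++⁻ (map (x ∷_) (subseqs l xs)) s∈
... | inj₂ s∈′ = let s⊆ , len = ∈-subseqs⁻ (suc l) xs s∈′ in x ∷ʳ s⊆ , len
... | inj₁ s∈′ with ∈-map⁻ (x ∷_) s∈′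
...   | s′ , s′∈ , refl = let s′⊆ , len = ∈-subseqs⁻ l xs s′∈ in refl ∷ s′⊆ , cong suc len

∈-subseqs⁺ : {xs s : List X} → s ⊆ xs → s ∈ subseqs (length s) xs
∈-subseqs⁺ {s = []}    _          = here refl
∈-subseqs⁺ {s = _ ∷ _} (y ∷ʳ s⊆)  = ∈-++⁺ʳ _ (∈-subseqs⁺ s⊆)
∈-subseqs⁺ {s = x ∷ _} (refl ∷ s⊆) = ∈-++⁺ˡ (∈-map⁺ (x ∷_) (∈-subseqs⁺ s⊆))

AllPairs-resp-⊆ : ∀ {R : ℕ → ℕ → Set} {s t} → s ⊆ t → AllPairs R t → AllPairs R s
AllPairs-resp-⊆ []          []               = []
AllPairs-resp-⊆ (_ ∷ʳ s⊆)   (_ ∷ ordered)    = AllPairs-resp-⊆ s⊆ ordered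
AllPairs-resp-⊆ (refl ∷ s⊆) (x~ ∷ ordered)   = All-resp-⊆ s⊆ x~ ∷ AllPairs-resp-⊆ s⊆ ordered

∈-tail : ∀ {x z} {L : List ℕ} → z ∈ x ∷ L → x < z → z ∈ L
∈-tail (here refl) x<x = ⊥-elim (<-irrefl refl x<x)
∈-tail (there z∈)  _   = z∈

ascending⇒⊆ : ∀ {L t} → AllPairs _<_ L → AllPairs _<_ t → All (_∈ L) t → t ⊆ L
ascending⇒⊆ {L} {[]} _ _ _ = minimum L
ascending⇒⊆ {x ∷ L} {y ∷ t} (x< ∷ L↑) (y< ∷ t↑) (here refl ∷ t∈) =
  refl ∷ ascending⇒⊆ L↑ t↑ (All.zipWith (λ (z∈ , y<z) → ∈-tail z∈ y<z) (t∈ , y<))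
ascending⇒⊆ {x ∷ L} {y ∷ t} (x< ∷ L↑) (y< ∷ t↑) (there y∈L ∷ t∈) =
  x ∷ʳ ascending⇒⊆ L↑ (y< ∷ t↑) (y∈L ∷ All.zipWith (λ (z∈ , y<z) → ∈-tail z∈ (<-trans x<y y<z)) (t∈ , y<))
  where
  x<y = All.lookup x< y∈L

ComparisonsAgree : List (ℕ × ℕ) → Set
ComparisonsAgree ps =
  ∀ {p q} → p ∈ ps → q ∈ ps → (proj₁ p <ᵇ proj₁ q) ≡ (proj₂ p <ᵇ proj₂ q)

T-orderIsoᵇ : (s τ : List ℕ) →
  T (orderIsoᵇ s τ) ⇔ (length s ≡ length τ × ComparisonsAgree (zip s τ))
T-orderIsoᵇ s τ = mk⇔ to from
  where
  ps = zip s τ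
  to : T (orderIsoᵇ s τ) → length s ≡ length τ × ComparisonsAgree ps
  to h = let len , agree = Equivalence.to T-∧ h in
    Equivalence.to T-≡ᵇ len ,
    λ {p} {q} p∈ q∈ → Equivalence.to T-≟ (All.lookup (Equivalence.to (T-allᵇ _ ps)
                (All.lookup (Equivalence.to (T-allᵇ _ ps) agree) p∈)) q∈)
  from : length s ≡ length τ × ComparisonsAgree ps → T (orderIsoᵇ s τ)
  from (len , agree) = Equivalence.from T-∧ (Equivalence.from T-≡ᵇ len ,
    Equivalence.from (T-allᵇ _ ps) (All.tabulate λ p∈ →
      Equivalence.from (T-allᵇ _ ps) (All.tabulate λ q∈ → Equivalence.from T-≟ (agree p∈ q∈))))

orderIsoᵇ-tail : ∀ {x y} s τ → T (orderIsoᵇ (x ∷ s) (y ∷ τ)) → T (orderIsoᵇ s τ)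
orderIsoᵇ-tail s τ iso = let len , agree = Equivalence.to (T-orderIsoᵇ (_ ∷ s) (_ ∷ τ)) iso in
  Equivalence.from (T-orderIsoᵇ s τ) (suc-injective len , λ p∈ q∈ → agree (there p∈) (there q∈))

zip-map-suc : (s τ : List ℕ) → zip (map suc s) τ ≡ map (map₁ suc) (zip s τ)
zip-map-suc []      _       = refl
zip-map-suc (_ ∷ _) []      = refl
zip-map-suc (x ∷ s) (y ∷ τ) = cong ((suc x , y) ∷_) (zip-map-suc s τ)

orderIsoᵇ-map-suc : (s τ : List ℕ) → orderIsoᵇ (map suc s) τ ≡ orderIsoᵇ s τ
orderIsoᵇ-map-suc s τ = T⇔T⇒≡ (mk⇔
  (λ iso → let len , agree = to (T-orderIsoᵇ (map suc s) τ) iso in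
    from (T-orderIsoᵇ s τ) (trans (sym (length-map suc s)) len ,
      λ p∈ q∈ → agree (shift (∈-map⁺ (map₁ suc) p∈)) (shift (∈-map⁺ (map₁ suc) q∈))))
  (λ iso → let len , agree = to (T-orderIsoᵇ s τ) iso in
    from (T-orderIsoᵇ (map suc s) τ) (trans (length-map suc s) len , λ p∈ q∈ → agree′ agree p∈ q∈)))
  where
  open Equivalence
  shift : ∀ {p} → p ∈ map (map₁ suc) (zip s τ) → p ∈ zip (map suc s) τ
  shift = subst (_ ∈_) (sym (zip-map-suc s τ))
  agree′ : ComparisonsAgree (zip s τ) → ComparisonsAgree (zip (map suc s) τ)
  agree′ agree p∈ q∈
    with ∈-map⁻ (map₁ suc) (subst (_ ∈_) (zip-map-suc s τ) p∈)
       | ∈-map⁻ (map₁ suc) (subst (_ ∈_) (zip-map-suc s τ) q∈)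
  ... | _ , p′∈ , refl | _ , q′∈ , refl = agree p′∈ q′∈

T-containsᵇ : (α τ : List ℕ) → T (containsᵇ α τ) ⇔ ∃ λ s → s ⊆ α × T (orderIsoᵇ s τ)
T-containsᵇ α τ = mk⇔
  (λ h → let s , s∈ , iso = find (to (T-anyᵇ (λ s → orderIsoᵇ s τ) occurrences) h) in
    s , proj₁ (∈-subseqs⁻ (length τ) α s∈) , iso)
  (λ (s , s⊆ , iso) → from (T-anyᵇ (λ s → orderIsoᵇ s τ) occurrences)
    (lose (subst (λ l → s ∈ subseqs l α) (proj₁ (to (T-orderIsoᵇ s τ) iso)) (∈-subseqs⁺ s⊆)) iso))
  where
  open Equivalence
  occurrences = subseqs (length τ) α

⊆-map⁻ : (f : ℕ → ℕ) {s : List ℕ} (t : List ℕ) → s ⊆ map f t → ∃ λ s′ → s ≡ map f s′ × s′ ⊆ t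
⊆-map⁻ f []      []          = [] , refl , []
⊆-map⁻ f (y ∷ t) (_ ∷ʳ s⊆) with ⊆-map⁻ f t s⊆
... | s′ , refl , s′⊆ = s′ , refl , y ∷ʳ s′⊆
⊆-map⁻ f (y ∷ t) (refl ∷ s⊆) with ⊆-map⁻ f t s⊆
... | s′ , refl , s′⊆ = y ∷ s′ , refl , refl ∷ s′⊆

containsᵇ-map-suc : (σ τ : List ℕ) → containsᵇ (map suc σ) τ ≡ containsᵇ σ τ
containsᵇ-map-suc σ τ = T⇔T⇒≡ (mk⇔
  (λ h → let s , s⊆ , iso = to (T-containsᵇ (map suc σ) τ) h
             s′ , s≡ , s′⊆ = ⊆-map⁻ suc σ s⊆ in
    from (T-containsᵇ σ τ)
      (s′ , s′⊆ , subst T (orderIsoᵇ-map-suc s′ τ) (subst (λ s → T (orderIsoᵇ s τ)) s≡ iso)))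
  (λ h → let s , s⊆ , iso = to (T-containsᵇ σ τ) h in
    from (T-containsᵇ (map suc σ) τ) (map suc s , map⁺ suc s⊆ , subst T (sym (orderIsoᵇ-map-suc s τ)) iso)))
  where open Equivalence

⊆-split : ∀ (a : List ℕ) {b s x} → s ⊆ a ++ x ∷ b →
  s ⊆ a ++ b ⊎ ∃ λ s₁ → ∃ λ s₂ → s ≡ s₁ ++ x ∷ s₂ × s₁ ⊆ a × s₂ ⊆ b
⊆-split []      (_ ∷ʳ s⊆)   = inj₁ s⊆
⊆-split []      (refl ∷ s⊆) = inj₂ ([] , _ , refl , [] , s⊆)
⊆-split (y ∷ a) (_ ∷ʳ s⊆) with ⊆-split a s⊆
... | inj₁ s⊆′                         = inj₁ (y ∷ʳ s⊆′)
... | inj₂ (s₁ , s₂ , s≡ , s₁⊆ , s₂⊆)  = inj₂ (s₁ , s₂ , s≡ , y ∷ʳ s₁⊆ , s₂⊆)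
⊆-split (y ∷ a) (refl ∷ s⊆) with ⊆-split a s⊆
... | inj₁ s⊆′                         = inj₁ (refl ∷ s⊆′)
... | inj₂ (s₁ , s₂ , refl , s₁⊆ , s₂⊆) = inj₂ (y ∷ s₁ , s₂ , refl , refl ∷ s₁⊆ , s₂⊆)

containsᵇ-insert : ∀ (a : List ℕ) {b x} τ →
  (∀ {s₁ s₂} → s₁ ⊆ a → s₂ ⊆ b → ¬ T (orderIsoᵇ (s₁ ++ x ∷ s₂) τ)) →
  containsᵇ (a ++ x ∷ b) τ ≡ containsᵇ (a ++ b) τ
containsᵇ-insert a {b} {x} τ noOccurrence = T⇔T⇒≡ (mk⇔ remove insert)
  where
  open Equivalence
  remove : T (containsᵇ (a ++ x ∷ b) τ) → T (containsᵇ (a ++ b) τ)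
  remove h with to (T-containsᵇ _ τ) h
  ... | s , s⊆ , iso with ⊆-split a s⊆
  ...   | inj₁ s⊆′                          = from (T-containsᵇ _ τ) (s , s⊆′ , iso)
  ...   | inj₂ (s₁ , s₂ , refl , s₁⊆ , s₂⊆) = ⊥-elim (noOccurrence s₁⊆ s₂⊆ iso)
  insert : T (containsᵇ (a ++ b) τ) → T (containsᵇ (a ++ x ∷ b) τ)
  insert h = let s , s⊆ , iso = to (T-containsᵇ _ τ) h in
    from (T-containsᵇ _ τ) (s , ⊆-trans s⊆ (++⁺ ⊆-refl (x ∷ʳ ⊆-refl)) , iso)

∈-zipʳ : ∀ {s τ : List ℕ} {y} → length s ≡ length τ → y ∈ τ → ∃ λ x → x ∈ s × (x , y) ∈ zip s τ
∈-zipʳ {x ∷ s} {_ ∷ τ} _   (here refl) = x , here refl , here refl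
∈-zipʳ {x ∷ s} {_ ∷ τ} len (there y∈)  =
  let x′ , x′∈ , p∈ = ∈-zipʳ (suc-injective len) y∈ in x′ , there x′∈ , there p∈

-- In τ the entry at position |s₁| exceeds the later entry 1, while in s nothing after the 1 is smaller.
¬orderIsoᵇ-early1 : ∀ s₁ {s₂} t₁ {t₂} → All (1 ≤_) s₂ → All (2 ≤_) t₁ → length s₁ < length t₁ →
  ¬ T (orderIsoᵇ (s₁ ++ 1 ∷ s₂) (t₁ ++ 1 ∷ t₂))
¬orderIsoᵇ-early1 (_ ∷ s₁) {s₂} (_ ∷ t₁) {t₂} s₂≥1 (_ ∷ t₁≥2) (s≤s lt) iso =
  ¬orderIsoᵇ-early1 s₁ t₁ s₂≥1 t₁≥2 lt (orderIsoᵇ-tail (s₁ ++ 1 ∷ s₂) (t₁ ++ 1 ∷ t₂) iso)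
¬orderIsoᵇ-early1 [] {s₂} (c ∷ t₁) {t₂} s₂≥1 (c≥2 ∷ _) _ iso =
  let len , agree = Equivalence.to (T-orderIsoᵇ (1 ∷ s₂) (c ∷ t₁ ++ 1 ∷ t₂)) iso
      d , d∈ , d1∈ = ∈-zipʳ (suc-injective len) (∈-++⁺ʳ t₁ (here refl))
      d<1 = <ᵇ⇒< _ 1 (subst T (sym (agree (there d1∈) (here refl))) (<⇒<ᵇ c≥2))
  in <⇒≱ d<1 (All.lookup s₂≥1 d∈)

orderIsoᵇ-321 : ∀ {a b} → 1 < b → b < a → T (orderIsoᵇ (a ∷ b ∷ 1 ∷ []) (3 ∷ 2 ∷ 1 ∷ []))
orderIsoᵇ-321 {suc (suc a)} {suc (suc b)} (s≤s (s≤s _)) (s≤s (s≤s b<a))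
  rewrite ≤⇒≮ᵇ (≤-refl {a}) | ≤⇒≮ᵇ (≤-refl {b}) | ≤⇒≮ᵇ (<⇒≤ b<a) | Equivalence.to T-≡ (<⇒<ᵇ b<a) = _

ascendingᵇ : List ℕ → Bool
ascendingᵇ []          = true
ascendingᵇ (_ ∷ [])    = true
ascendingᵇ (x ∷ y ∷ t) = (x <ᵇ y) ∧ ascendingᵇ (y ∷ t)

ascendingᵇ⇒AllPairs : ∀ t → T (ascendingᵇ t) → AllPairs _<_ t
ascendingᵇ⇒AllPairs []          _ = []
ascendingᵇ⇒AllPairs (x ∷ [])    _ = [] ∷ []
ascendingᵇ⇒AllPairs (x ∷ y ∷ t) h =
  let x<ᵇy , rest = Equivalence.to T-∧ h
      x<y = <ᵇ⇒< x y x<ᵇy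
      ordered = ascendingᵇ⇒AllPairs (y ∷ t) rest
  in (x<y ∷ All.map (<-trans x<y) (AllPairs.head ordered)) ∷ ordered

AllPairs⇒ascendingᵇ : ∀ {t} → AllPairs _<_ t → T (ascendingᵇ t)
AllPairs⇒ascendingᵇ []                         = _
AllPairs⇒ascendingᵇ (_ ∷ [])                   = _
AllPairs⇒ascendingᵇ ((x<y ∷ _) ∷ ordered@(_ ∷ _)) =
  Equivalence.from T-∧ (<⇒<ᵇ x<y , AllPairs⇒ascendingᵇ ordered)

ascendingᵇ-map-suc : (t : List ℕ) → ascendingᵇ (map suc t) ≡ ascendingᵇ t
ascendingᵇ-map-suc []          = refl
ascendingᵇ-map-suc (x ∷ [])    = refl
ascendingᵇ-map-suc (x ∷ y ∷ t) = cong ((x <ᵇ y) ∧_) (ascendingᵇ-map-suc (y ∷ t))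

ascendingᵇ-snoc : ∀ u (a b : ℕ) → ascendingᵇ (u ++ a ∷ b ∷ []) ≡ ascendingᵇ (u ++ a ∷ []) ∧ (a <ᵇ b)
ascendingᵇ-snoc []          a b = ∧-identityʳ (a <ᵇ b)
ascendingᵇ-snoc (x ∷ [])    a b = cong ((x <ᵇ a) ∧_) (ascendingᵇ-snoc [] a b)
  ⟨ trans ⟩ sym (∧-assoc (x <ᵇ a) true (a <ᵇ b))
ascendingᵇ-snoc (x ∷ y ∷ u) a b = cong ((x <ᵇ y) ∧_) (ascendingᵇ-snoc (y ∷ u) a b)
  ⟨ trans ⟩ sym (∧-assoc (x <ᵇ y) _ (a <ᵇ b))

ascendingᵇ-1∷ : ∀ {t} → All (1 ≤_) t → ascendingᵇ (1 ∷ map suc t) ≡ ascendingᵇ t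
ascendingᵇ-1∷ []                  = refl
ascendingᵇ-1∷ {x ∷ t} (s≤s _ ∷ _) = ascendingᵇ-map-suc (x ∷ t)

-- Inserting a new least entry

take-length-++ : ∀ (a : List ℕ) {b} → take (length a) (a ++ b) ≡ a
take-length-++ []      = refl
take-length-++ (x ∷ a) = cong (x ∷_) (take-length-++ a)

drop-length-++ : ∀ (a : List ℕ) {b} → drop (length a) (a ++ b) ≡ b
drop-length-++ []      = refl
drop-length-++ (x ∷ a) = drop-length-++ a

++-cancel-length : ∀ (a a′ : List ℕ) {b b′} → length a ≡ length a′ → a ++ b ≡ a′ ++ b′ → a ≡ a′ × b ≡ b′
++-cancel-length []      []       _   eq = refl , eq
++-cancel-length (x ∷ a) (x′ ∷ a′) len eq =
  let x≡x′ , rest = ∷-injective eq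
      a≡a′ , b≡b′ = ++-cancel-length a a′ (suc-injective len) rest
  in cong₂ _∷_ x≡x′ a≡a′ , b≡b′

map-suc-pred : ∀ {xs} → All (1 ≤_) xs → map suc (map pred xs) ≡ xs
map-suc-pred {xs} xs≥1 = trans (sym (map-∘ xs)) (map-id-local (All.map (λ { (s≤s _) → refl }) xs≥1))

length-take-≤ : ∀ {j} (xs : List ℕ) → j ≤ length xs → length (take j xs) ≡ j
length-take-≤ {j} xs j≤ = trans (length-take j xs) (m≤n⇒m⊓n≡m j≤)

insert1 : ℕ → List ℕ → List ℕ
insert1 j σ = take j (map suc σ) ++ 1 ∷ drop j (map suc σ)

oneAtᵇ : ℕ → List ℕ → Bool
oneAtᵇ _       []      = false
oneAtᵇ zero    (x ∷ _) = x ≡ᵇ 1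
oneAtᵇ (suc j) (_ ∷ π) = oneAtᵇ j π

oneAtᵇ-length-++ : ∀ a {b} → T (oneAtᵇ (length a) (a ++ 1 ∷ b))
oneAtᵇ-length-++ []      = _
oneAtᵇ-length-++ (_ ∷ a) = oneAtᵇ-length-++ a

oneAtᵇ-split : ∀ j π → T (oneAtᵇ j π) → ∃ λ a → ∃ λ b → π ≡ a ++ 1 ∷ b × length a ≡ j
oneAtᵇ-split zero    (x ∷ π) h with Equivalence.to (T-≡ᵇ {x} {1}) h
... | refl = [] , π , refl , refl
oneAtᵇ-split (suc j) (x ∷ π) h with oneAtᵇ-split j π h
... | a , b , refl , refl = x ∷ a , b , refl , refl

oneAtᵇ-unique : ∀ {π} j → Unique π → T (oneAtᵇ 0 π) → ¬ T (oneAtᵇ (suc j) π)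
oneAtᵇ-unique {x ∷ π} j (x∉π ∷ _) first later with Equivalence.to (T-≡ᵇ {x} {1}) first
... | refl = let a , b , π≡ , _ = oneAtᵇ-split j π later in
  All¬⇒¬Any x∉π (subst (1 ∈_) (sym π≡) (∈-++⁺ʳ a (here refl)))

length-insert1 : ∀ j σ → length (insert1 j σ) ≡ suc (length σ)
length-insert1 j σ = begin
  length (front ++ 1 ∷ back)    ≡⟨ length-++-sucʳ front 1 back ⟩
  suc (length (front ++ back))  ≡⟨ cong (suc ∘ length) (take++drop≡id j (map suc σ)) ⟩
  suc (length (map suc σ))      ≡⟨ cong suc (length-map suc σ) ⟩
  suc (length σ)                ∎
  where
  open ≡-Reasoning
  front = take j (map suc σ)
  back  = drop j (map suc σ)

insert1-injective : ∀ j {σ σ′} → insert1 j σ ≡ insert1 j σ′ → σ ≡ σ′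
insert1-injective j {σ} {σ′} eq = map-injective suc-injective (begin
  map suc σ                                  ≡⟨ take++drop≡id j (map suc σ) ⟨
  take j (map suc σ) ++ drop j (map suc σ)   ≡⟨ cong₂ _++_ take≡ (∷-injectiveʳ drop≡) ⟩
  take j (map suc σ′) ++ drop j (map suc σ′) ≡⟨ take++drop≡id j (map suc σ′) ⟩
  map suc σ′                                 ∎)
  where
  open ≡-Reasoning
  |front| : ∀ σ → length (take j (map suc σ)) ≡ j ⊓ length σ
  |front| σ = trans (length-take j (map suc σ)) (cong (j ⊓_) (length-map suc σ))
  |σ|≡|σ′| : length σ ≡ length σ′
  |σ|≡|σ′| = suc-injective (trans (sym (length-insert1 j σ)) (trans (cong length eq) (length-insert1 j σ′)))
  |front|≡ : length (take j (map suc σ)) ≡ length (take j (map suc σ′))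
  |front|≡ = trans (|front| σ) (trans (cong (j ⊓_) |σ|≡|σ′|) (sym (|front| σ′)))
  take≡ = proj₁ (++-cancel-length _ _ |front|≡ eq)
  drop≡ = proj₂ (++-cancel-length _ _ |front|≡ eq)

oneAtᵇ-insert1 : ∀ j σ → j ≤ length σ → oneAtᵇ j (insert1 j σ) ≡ true
oneAtᵇ-insert1 j σ j≤ = Equivalence.to T-≡ (subst (λ l → T (oneAtᵇ l (insert1 j σ)))
  (length-take-≤ (map suc σ) (subst (j ≤_) (sym (length-map suc σ)) j≤))
  (oneAtᵇ-length-++ (take j (map suc σ))))

take-insert1 : ∀ j σ → j ≤ length σ → take j (insert1 j σ) ≡ map suc (take j σ)
take-insert1 j σ j≤ = begin
  take j (front ++ 1 ∷ back)              ≡⟨ cong (λ l → take l (front ++ 1 ∷ back)) |front| ⟨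
  take (length front) (front ++ 1 ∷ back) ≡⟨ take-length-++ front ⟩
  front                                   ≡⟨ take-map j σ ⟩
  map suc (take j σ)                      ∎
  where
  open ≡-Reasoning
  front = take j (map suc σ)
  back  = drop j (map suc σ)
  |front| : length front ≡ j
  |front| = length-take-≤ (map suc σ) (subst (j ≤_) (sym (length-map suc σ)) j≤)

insert1-isPermutation : ∀ {n} j {σ} → IsPermutation n σ → IsPermutation (suc n) (insert1 j σ)
insert1-isPermutation {n} j {σ} (isPermutation len u entries) = isPermutation
  (trans (length-insert1 j σ) (cong suc len))
  (Equivalence.from (Unique-shift front) (subst (All (1 ≢_)) (sym split) (All.map⁺ (All.map 1≢suc entries))
                                          ∷ subst Unique (sym split) (Unique.map⁺ suc-injective u)))
  (Equivalence.from (All-shift front) ((s≤s z≤n , s≤s z≤n)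
                                       ∷ subst (All _) (sym split) (All.map⁺ (All.map raise entries))))
  where
  front = take j (map suc σ)
  split : front ++ drop j (map suc σ) ≡ map suc σ
  split = take++drop≡id j (map suc σ)
  1≢suc : ∀ {x} → InRange n x → 1 ≢ suc x
  1≢suc (1≤x , _) refl = <-irrefl refl 1≤x
  raise : ∀ {x} → InRange n x → InRange (suc n) (suc x)
  raise (_ , x≤n) = s≤s z≤n , s≤s x≤n

insert1-surjective : ∀ {n} a {b} → IsPermutation (suc n) (a ++ 1 ∷ b) →
          ∃ λ σ → IsPermutation n σ × insert1 (length a) σ ≡ a ++ 1 ∷ b
insert1-surjective {n} a {b} (isPermutation len u entries)
  with Equivalence.to (Unique-shift a) u | Equivalence.to (All-shift a) entries
... | 1∉ ∷ u′ | _ ∷ entries′ = map pred (a ++ b) , isPermutation len′ unique′ entries″ , inserted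
  where
  ≥2 : All (2 ≤_) (a ++ b)
  ≥2 = All.zipWith (λ ((1≤x , _) , 1≢x) → ≤∧≢⇒< 1≤x 1≢x) (entries′ , 1∉)
  lowered : map suc (map pred (a ++ b)) ≡ a ++ b
  lowered = map-suc-pred (All.map <⇒≤ ≥2)
  len′ : length (map pred (a ++ b)) ≡ n
  len′ = trans (length-map pred (a ++ b)) (suc-injective (trans (sym (length-++-sucʳ a 1 b)) len))
  unique′ : Unique (map pred (a ++ b))
  unique′ = Unique.map⁻ (subst Unique (sym lowered) u′)
  entries″ : All (InRange n) (map pred (a ++ b))
  entries″ = All.map⁺ (All.zipWith (λ { (s≤s (s≤s _) , (_ , s≤s x≤n)) → s≤s z≤n , x≤n }) (≥2 , entries′))
  inserted : insert1 (length a) (map pred (a ++ b)) ≡ a ++ 1 ∷ b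
  inserted rewrite lowered = cong₂ (λ u v → u ++ 1 ∷ v) (take-length-++ a) (drop-length-++ a)

count-insert1 : ∀ n j (P : List ℕ → Bool) →
  (∀ {π} → π ∈ perms (suc n) → T (P π) → T (oneAtᵇ j π)) →
  count P (perms (suc n)) ≡ count (P ∘ insert1 j) (perms n)
count-insert1 n j P oneAt = begin
  length (filterᵇ P (perms (suc n)))  ≡⟨ ↭-length (∼bag⇒↭ (unique∧set⇒bag unique₁ unique₂ (mk⇔ to from))) ⟩
  length (map (insert1 j) preimages)  ≡⟨ length-map (insert1 j) preimages ⟩
  length preimages                    ∎
  where
  open ≡-Reasoning
  preimages = filterᵇ (P ∘ insert1 j) (perms n)
  unique₁ = Unique-filterᵇ P (Unique-perms (suc n))
  unique₂ = Unique.map⁺ (insert1-injective j) (Unique-filterᵇ (P ∘ insert1 j) (Unique-perms n))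
  to : ∀ {π} → π ∈ filterᵇ P (perms (suc n)) → π ∈ map (insert1 j) preimages
  to {π} π∈ with ∈-filterᵇ⁻ P π∈
  ... | π∈perms , Pπ with oneAtᵇ-split j π (oneAt π∈perms Pπ)
  ... | a , b , refl , refl with insert1-surjective a (∈-perms⁻ (suc n) π∈perms)
  ... | σ , isPerm , inserted = subst (_∈ _) inserted (∈-map⁺ (insert1 j)
          (∈-filterᵇ⁺ (P ∘ insert1 j) (∈-perms⁺ n isPerm) (subst (T ∘ P) (sym inserted) Pπ)))
  from : ∀ {π} → π ∈ map (insert1 j) preimages → π ∈ filterᵇ P (perms (suc n))
  from π∈ with ∈-map⁻ (insert1 j) π∈
  ... | σ , σ∈ , refl with ∈-filterᵇ⁻ (P ∘ insert1 j) σ∈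
  ... | σ∈perms , Pσ = ∈-filterᵇ⁺ P (∈-perms⁺ (suc n) (insert1-isPermutation j (∈-perms⁻ n σ∈perms))) Pσ

-- Inserting 1 early preserves pattern avoidance

drop-map-suc≥1 : ∀ j σ → All (1 ≤_) (drop j (map suc σ))
drop-map-suc≥1 j σ = All.drop⁺ j (All.map⁺ (All.universal (λ _ → s≤s z≤n) σ))

containsᵇ-insert1 : ∀ j σ τ →
  (∀ {s₁ s₂} → s₁ ⊆ take j (map suc σ) → s₂ ⊆ drop j (map suc σ) → ¬ T (orderIsoᵇ (s₁ ++ 1 ∷ s₂) τ)) →
  containsᵇ (insert1 j σ) τ ≡ containsᵇ σ τ
containsᵇ-insert1 j σ τ noOccurrence = begin
  containsᵇ (front ++ 1 ∷ back) τ  ≡⟨ containsᵇ-insert front τ noOccurrence ⟩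
  containsᵇ (front ++ back) τ      ≡⟨ cong (λ α → containsᵇ α τ) (take++drop≡id j (map suc σ)) ⟩
  containsᵇ (map suc σ) τ          ≡⟨ containsᵇ-map-suc σ τ ⟩
  containsᵇ σ τ                    ∎
  where
  open ≡-Reasoning
  front = take j (map suc σ)
  back  = drop j (map suc σ)

record LateOne (ℓ : ℕ) (τ : List ℕ) : Set where
  constructor lateOne
  field
    before after : List ℕ
    split        : τ ≡ before ++ 1 ∷ after
    before≥2     : All (2 ≤_) before
    ℓ≤length     : ℓ ≤ length before

containsᵇ-insert1-lateOne : ∀ {ℓ τ} j σ → j < ℓ → LateOne ℓ τ → containsᵇ (insert1 j σ) τ ≡ containsᵇ σ τ
containsᵇ-insert1-lateOne j σ j<ℓ (lateOne t₁ t₂ refl t₁≥2 ℓ≤) = containsᵇ-insert1 j σ _ λ {s₁} s₁⊆ s₂⊆ →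
  ¬orderIsoᵇ-early1 s₁ t₁ (All-resp-⊆ s₂⊆ (drop-map-suc≥1 j σ)) t₁≥2 (begin-strict
      length s₁                       ≤⟨ length-mono-≤ s₁⊆ ⟩
      length (take j (map suc σ))     ≡⟨ length-take j (map suc σ) ⟩
      j ⊓ length (map suc σ)          ≤⟨ m⊓n≤m j _ ⟩
      j                               <⟨ j<ℓ ⟩
      _                               ≤⟨ ℓ≤ ⟩
      length t₁                       ∎)
  where open ≤-Reasoning

containsᵇ-insert1-321 : ∀ j σ → T (ascendingᵇ (take j σ)) →
  containsᵇ (insert1 j σ) (3 ∷ 2 ∷ 1 ∷ []) ≡ containsᵇ σ (3 ∷ 2 ∷ 1 ∷ [])
containsᵇ-insert1-321 j σ asc = containsᵇ-insert1 j σ _ noOccurrence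
  where
  front-ascending : AllPairs _<_ (take j (map suc σ))
  front-ascending = ascendingᵇ⇒AllPairs _
    (subst T (sym (trans (cong ascendingᵇ (take-map j σ)) (ascendingᵇ-map-suc (take j σ)))) asc)
  noOccurrence : ∀ {s₁ s₂} → s₁ ⊆ take j (map suc σ) → s₂ ⊆ drop j (map suc σ) →
                 ¬ T (orderIsoᵇ (s₁ ++ 1 ∷ s₂) (3 ∷ 2 ∷ 1 ∷ []))
  noOccurrence {[]}        _   s₂⊆ = ¬orderIsoᵇ-early1 [] (3 ∷ 2 ∷ []) {[]}
    (All-resp-⊆ s₂⊆ (drop-map-suc≥1 j σ)) (s≤s (s≤s z≤n) ∷ s≤s (s≤s z≤n) ∷ []) (s≤s z≤n)
  noOccurrence {x ∷ []}    _   s₂⊆ = ¬orderIsoᵇ-early1 (x ∷ []) (3 ∷ 2 ∷ []) {[]}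
    (All-resp-⊆ s₂⊆ (drop-map-suc≥1 j σ)) (s≤s (s≤s z≤n) ∷ s≤s (s≤s z≤n) ∷ []) (s≤s (s≤s z≤n))
  noOccurrence {a ∷ b ∷ s₁} {s₂} s₁⊆ _ iso with AllPairs-resp-⊆ s₁⊆ front-ascending
  ... | (a<b ∷ _) ∷ _ = subst T (proj₂ (Equivalence.to (T-orderIsoᵇ (a ∷ b ∷ s₁ ++ 1 ∷ s₂) _) iso)
                                         (here refl) (there (here refl))) (<⇒<ᵇ a<b)

module _ (k′ : ℕ) where
  private
    k = 2 + k′
    middle = range (k + 2) (2 * k ∸ 1)

    length-middle : length middle ≡ k′
    length-middle = trans (length-range (k + 2) (2 * k ∸ 1))
      (trans ([m+n]∸[m+o]≡n∸o k′ (2 + (k′ + 0)) 2) (+-identityʳ k′))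

    middle≥2 : All (2 ≤_) middle
    middle≥2 = All.tabulate (λ x∈ → ≤-trans (s≤s (s≤s z≤n)) (proj₁ (∈-range⁻ (k + 2) (2 * k ∸ 1) x∈)))

    lateOne-short : ∀ h {t₂} → 2 ≤ h → LateOne (suc k′) ((h ∷ middle) ++ 1 ∷ t₂)
    lateOne-short h h≥2 = lateOne _ _ refl (h≥2 ∷ middle≥2) (s≤s (≤-reflexive (sym length-middle)))

    lateOne-long : ∀ h {t₂} → 2 ≤ h → LateOne (suc k′) (h ∷ middle ++ 2 * k ∷ 1 ∷ t₂)
    lateOne-long h h≥2 = lateOne (h ∷ middle ++ 2 * k ∷ []) _ (cong (h ∷_) (sym (++-assoc middle _ _)))
      (h≥2 ∷ All.++⁺ middle≥2 (s≤s (s≤s z≤n) ∷ []))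
      (s≤s (begin
        k′                                 ≡⟨ length-middle ⟨
        length middle                      ≤⟨ m≤m+n (length middle) 1 ⟩
        length middle + 1                  ≡⟨ length-++ middle ⟨
        length (middle ++ 2 * k ∷ [])      ∎))
      where open ≤-Reasoning

  gonAvoidingᵇ-insert1 : ∀ j σ → j ≤ k′ → T (ascendingᵇ (take j σ)) →
    gonAvoidingᵇ k (insert1 j σ) ≡ gonAvoidingᵇ k σ
  gonAvoidingᵇ-insert1 j σ j≤k′ asc =
    cong₂ _∧_ (cong not (containsᵇ-insert1-321 j σ asc))
   (cong₂ _∧_ (cong not (late (lateOne-short k (s≤s (s≤s z≤n)))))
   (cong₂ _∧_ (cong not (late (lateOne-long k (s≤s (s≤s z≤n)))))
   (cong₂ _∧_ (cong not (late (lateOne-short (k + 1) (s≤s (s≤s z≤n)))))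
              (cong not (late (lateOne-long (k + 1) (s≤s (s≤s z≤n))))))))
    where
    late : ∀ {τ} → LateOne (suc k′) τ → containsᵇ (insert1 j σ) τ ≡ containsᵇ σ τ
    late = containsᵇ-insert1-lateOne j σ (s≤s j≤k′)

-- Counting avoiders with an ascending prefix

countAvoiding : ℕ → ℕ → (List ℕ → Bool) → ℕ
countAvoiding k n P = count (λ π → gonAvoidingᵇ k π ∧ P π) (perms n)

fAsc : ℕ → ℕ → ℕ → ℕ
fAsc k n j = countAvoiding k n (λ π → ascendingᵇ (take j π))

fAsc-≤1 : ∀ k n j → j ≤ 1 → fAsc k n j ≡ f k n
fAsc-≤1 k n j j≤1 = count-cong {xs = perms n} λ {π} _ →
  trans (cong (gonAvoidingᵇ k π ∧_) (short j π j≤1)) (∧-identityʳ _)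
  where
  short : ∀ j π → j ≤ 1 → ascendingᵇ (take j π) ≡ true
  short zero       π       _         = refl
  short (suc zero) []      _         = refl
  short (suc zero) (_ ∷ _) _         = refl
  short (suc (suc _)) _    (s≤s ())

countAvoiding-split-first1 : ∀ k n (P : List ℕ → Bool) →
  countAvoiding k n P ≡
  countAvoiding k n (λ π → oneAtᵇ 0 π ∧ P π) + countAvoiding k n (λ π → not (oneAtᵇ 0 π) ∧ P π)
countAvoiding-split-first1 k n P =
  count-split {xs = perms n} λ {π} _ → split (gonAvoidingᵇ k π) (oneAtᵇ 0 π) (P π)
  where
  split : ∀ g h p → indicator (g ∧ p) ≡ indicator (g ∧ (h ∧ p)) + indicator (g ∧ (not h ∧ p))
  split false _     _ = refl
  split true  true  p = sym (+-identityʳ _)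
  split true  false p = refl

module _ (k′ : ℕ) where
  private
    k = 2 + k′

  countAvoiding-oneAt : ∀ n p (Q R : List ℕ → Bool) → p ≤ k′ → p ≤ n →
    (∀ {σ} → σ ∈ perms n → Q (insert1 p σ) ≡ R σ) → (∀ {σ} → T (R σ) → T (ascendingᵇ (take p σ))) →
    countAvoiding k (suc n) (λ π → oneAtᵇ p π ∧ Q π) ≡ countAvoiding k n R
  countAvoiding-oneAt n p Q R p≤k′ p≤n Q≡R R⇒asc = trans (count-insert1 n p _ oneAt) (count-cong pointwise)
    where
    oneAt : ∀ {π} → π ∈ perms (suc n) → T (gonAvoidingᵇ k π ∧ (oneAtᵇ p π ∧ Q π)) → T (oneAtᵇ p π)
    oneAt {π} _ h = proj₁ (Equivalence.to T-∧ (proj₂ (Equivalence.to (T-∧ {gonAvoidingᵇ k π}) h)))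
    pointwise : ∀ {σ} → σ ∈ perms n →
      gonAvoidingᵇ k (insert1 p σ) ∧ (oneAtᵇ p (insert1 p σ) ∧ Q (insert1 p σ)) ≡ gonAvoidingᵇ k σ ∧ R σ
    pointwise {σ} σ∈ rewrite Q≡R σ∈ | oneAtᵇ-insert1 p σ (≤-length-perm σ∈ p≤n)
      with R σ in r
    ... | true  = cong (_∧ true) (gonAvoidingᵇ-insert1 k′ p σ p≤k′ (R⇒asc (subst T (sym r) _)))
    ... | false = trans (∧-zeroʳ _) (sym (∧-zeroʳ _))

  countAvoiding-first1 : ∀ n j →
    countAvoiding k (suc n) (λ π → oneAtᵇ 0 π ∧ ascendingᵇ (take (suc j) π)) ≡ fAsc k n j
  countAvoiding-first1 n j = countAvoiding-oneAt n 0 _ _ z≤n z≤n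
    (λ {σ} σ∈ → trans (cong (λ t → ascendingᵇ (1 ∷ t)) (take-map j σ))
      (ascendingᵇ-1∷ (All.take⁺ j (All.map proj₁ (IsPermutation.entries (∈-perms⁻ n σ∈))))))
    (λ _ → _)

  countAvoiding-1at : ∀ n j → j ≤ k′ → j ≤ n →
    countAvoiding k (suc n) (λ π → oneAtᵇ j π ∧ ascendingᵇ (take j π)) ≡ fAsc k n j
  countAvoiding-1at n j j≤k′ j≤n = countAvoiding-oneAt n j _ _ j≤k′ j≤n (λ {σ} σ∈ → trans
    (cong ascendingᵇ (take-insert1 j σ (≤-length-perm σ∈ j≤n)))
    (ascendingᵇ-map-suc (take j σ))) id

indicator-partition : ∀ g h e I c →
  (T g → T I → T h → T e → ⊥) → (T e → T c → ⊥) → (T g → T I → ¬ T h → ¬ T e → T c) →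
  indicator (g ∧ (not h ∧ I)) ≡ indicator (g ∧ (e ∧ I)) + indicator (g ∧ (not h ∧ (I ∧ c)))
indicator-partition false _     _     _     _     _  _  _  = refl
indicator-partition true  true  false _     _     _  _  _  = refl
indicator-partition true  true  true  false _     _  _  _  = refl
indicator-partition true  true  true  true  _     k₁ _  _  = ⊥-elim (k₁ _ _ _ _)
indicator-partition true  false true  false _     _  _  _  = refl
indicator-partition true  false true  true  false _  _  _  = refl
indicator-partition true  false true  true  true  _  k₂ _  = ⊥-elim (k₂ _ _)
indicator-partition true  false false false _     _  _  _  = refl
indicator-partition true  false false true  true  _  _  _  = refl
indicator-partition true  false false true  false _  _  k₃ = ⊥-elim (k₃ _ _ (λ ()) (λ ()))

split-at₂ : ∀ (π : List ℕ) i → 2 + i ≤ length π →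
  ∃ λ u → ∃ λ a → ∃ λ b → ∃ λ v → π ≡ u ++ a ∷ b ∷ v × length u ≡ i
split-at₂ (a ∷ b ∷ v) zero    _         = [] , a , b , v , refl , refl
split-at₂ (x ∷ π)     (suc i) (s≤s 2+i≤) with split-at₂ π i 2+i≤
... | u , a , b , v , refl , refl = x ∷ u , a , b , v , refl , refl

take-suc-length : ∀ u {a : ℕ} {w} → take (suc (length u)) (u ++ a ∷ w) ≡ u ++ a ∷ []
take-suc-length []      = refl
take-suc-length (x ∷ u) = cong (x ∷_) (take-suc-length u)

take-2+length : ∀ u {a b : ℕ} {w} → take (2 + length u) (u ++ a ∷ b ∷ w) ≡ u ++ a ∷ b ∷ []
take-2+length []      = refl
take-2+length (x ∷ u) = cong (x ∷_) (take-2+length u)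

oneAtᵇ-suc-length : ∀ u {a b : ℕ} {v} → oneAtᵇ (suc (length u)) (u ++ a ∷ b ∷ v) ≡ (b ≡ᵇ 1)
oneAtᵇ-suc-length []      = refl
oneAtᵇ-suc-length (_ ∷ u) = oneAtᵇ-suc-length u

ascending-prefix≥2 : ∀ w {w′} → AllPairs _<_ w → All (1 ≤_) (w ++ w′) → ¬ T (oneAtᵇ 0 (w ++ w′)) → All (2 ≤_) w
ascending-prefix≥2 []      _        _         _     = []
ascending-prefix≥2 (x ∷ w) (x< ∷ _) (1≤x ∷ _) first≢1 = x≥2 ∷ All.map (λ x<y → ≤-trans x≥2 (<⇒≤ x<y)) x<
  where
  x≥2 : 2 ≤ x
  x≥2 = ≤∧≢⇒< 1≤x (λ 1≡x → first≢1 (Equivalence.from T-≡ᵇ (sym 1≡x)))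

descent⇒contains321 : ∀ {n} u {a b v} → IsPermutation (suc n) (u ++ a ∷ b ∷ v) →
  AllPairs _<_ (u ++ a ∷ []) → ¬ T (oneAtᵇ 0 (u ++ a ∷ b ∷ v)) → b ≢ 1 → b < a →
  T (containsᵇ (u ++ a ∷ b ∷ v) (3 ∷ 2 ∷ 1 ∷ []))
descent⇒contains321 u {a} {b} {v} perm ascending first≢1 b≢1 b<a =
  Equivalence.from (T-containsᵇ _ (3 ∷ 2 ∷ 1 ∷ []))
    (a ∷ b ∷ 1 ∷ [] , ++⁺ˡ u (refl ∷ refl ∷ from∈ 1∈v) , orderIsoᵇ-321 1<b b<a)
  where
  π≡ : (u ++ a ∷ []) ++ b ∷ v ≡ u ++ a ∷ b ∷ v
  π≡ = ++-assoc u (a ∷ []) (b ∷ v)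
  ≥1 : All (1 ≤_) (u ++ a ∷ b ∷ v)
  ≥1 = All.map proj₁ (IsPermutation.entries perm)
  prefix≥2 : All (2 ≤_) (u ++ a ∷ [])
  prefix≥2 = ascending-prefix≥2 (u ++ a ∷ []) ascending (subst (All (1 ≤_)) (sym π≡) ≥1)
                                (first≢1 ∘ subst (T ∘ oneAtᵇ 0) π≡)
  1<b : 1 < b
  1<b = ≤∧≢⇒< (All.lookup ≥1 (∈-++⁺ʳ u (there (here refl)))) (b≢1 ∘ sym)
  1∈v : 1 ∈ v
  1∈v with ∈-++⁻ (u ++ a ∷ []) (subst (1 ∈_) (sym π≡) (1∈perm perm))
  ... | inj₁ 1∈prefix       = ⊥-elim (<-irrefl refl (All.lookup prefix≥2 1∈prefix))
  ... | inj₂ (here 1≡b)     = ⊥-elim (b≢1 (sym 1≡b))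
  ... | inj₂ (there 1∈v)    = 1∈v

gonAvoidingᵇ⇒¬321 : ∀ k π → T (gonAvoidingᵇ k π) → ¬ T (containsᵇ π (3 ∷ 2 ∷ 1 ∷ []))
gonAvoidingᵇ⇒¬321 k π avoiding contains =
  subst (T ∘ not) (Equivalence.to T-≡ contains) (proj₁ (Equivalence.to T-∧ avoiding))

indicator-next1-or-ascent : ∀ k {n} u {a b v} → IsPermutation (suc n) (u ++ a ∷ b ∷ v) →
  let π = u ++ a ∷ b ∷ v in
  indicator (gonAvoidingᵇ k π ∧ (not (oneAtᵇ 0 π) ∧ ascendingᵇ (take (suc (length u)) π))) ≡
  indicator (gonAvoidingᵇ k π ∧ (oneAtᵇ (suc (length u)) π ∧ ascendingᵇ (take (suc (length u)) π))) +
  indicator (gonAvoidingᵇ k π ∧ (not (oneAtᵇ 0 π) ∧ ascendingᵇ (take (2 + length u) π)))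
indicator-next1-or-ascent k u {a} {b} {v} perm
  rewrite take-suc-length u {a} {b ∷ v} | take-2+length u {a} {b} {v} | ascendingᵇ-snoc u a b =
  indicator-partition (gonAvoidingᵇ k π) (oneAtᵇ 0 π) (oneAtᵇ (suc (length u)) π) _ (a <ᵇ b)
    (λ _ _ first1 later1 → oneAtᵇ-unique (length u) (IsPermutation.unique perm) first1 later1)
    (λ later1 a<ᵇb → <⇒≱ (subst (a <_) (b≡1 later1) (<ᵇ⇒< a b a<ᵇb)) (All.lookup ≥1 (∈-++⁺ʳ u (here refl))))
    ascent
  where
  π = u ++ a ∷ b ∷ v
  ≥1 : All (1 ≤_) π
  ≥1 = All.map proj₁ (IsPermutation.entries perm)
  b≡1 : T (oneAtᵇ (suc (length u)) π) → b ≡ 1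
  b≡1 later1 = Equivalence.to T-≡ᵇ (subst T (oneAtᵇ-suc-length u) later1)
  a≢b : a ≢ b
  a≢b with subst Unique (drop-length-++ u) (Unique.drop⁺ (length u) (IsPermutation.unique perm))
  ... | (a≢b ∷ _) ∷ _ = a≢b
  ascent : T (gonAvoidingᵇ k π) → T (ascendingᵇ (u ++ a ∷ [])) → ¬ T (oneAtᵇ 0 π) →
           ¬ T (oneAtᵇ (suc (length u)) π) → T (a <ᵇ b)
  ascent avoiding ascending first≢1 later≢1 with <-cmp a b
  ... | tri< a<b _ _ = <⇒<ᵇ a<b
  ... | tri≈ _ a≡b _ = ⊥-elim (a≢b a≡b)
  ... | tri> _ _ b<a = ⊥-elim (gonAvoidingᵇ⇒¬321 k π avoiding
          (descent⇒contains321 u perm (ascendingᵇ⇒AllPairs _ ascending) first≢1 (later≢1 ∘ later1) b<a))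
    where
    later1 : b ≡ 1 → T (oneAtᵇ (suc (length u)) π)
    later1 refl = subst T (sym (oneAtᵇ-suc-length u)) _

countAvoiding-next1-or-ascent : ∀ k n i → 2 + i ≤ suc n →
  countAvoiding k (suc n) (λ π → not (oneAtᵇ 0 π) ∧ ascendingᵇ (take (suc i) π)) ≡
  countAvoiding k (suc n) (λ π → oneAtᵇ (suc i) π ∧ ascendingᵇ (take (suc i) π)) +
  countAvoiding k (suc n) (λ π → not (oneAtᵇ 0 π) ∧ ascendingᵇ (take (2 + i) π))
countAvoiding-next1-or-ascent k n i 2+i≤ = count-split {xs = perms (suc n)} pointwise
  where
  pointwise : ∀ {π} → π ∈ perms (suc n) →
    indicator (gonAvoidingᵇ k π ∧ (not (oneAtᵇ 0 π) ∧ ascendingᵇ (take (suc i) π))) ≡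
    indicator (gonAvoidingᵇ k π ∧ (oneAtᵇ (suc i) π ∧ ascendingᵇ (take (suc i) π))) +
    indicator (gonAvoidingᵇ k π ∧ (not (oneAtᵇ 0 π) ∧ ascendingᵇ (take (2 + i) π)))
  pointwise {π} π∈ with split-at₂ π i (≤-length-perm π∈ 2+i≤)
  ... | u , a , b , v , refl , refl = indicator-next1-or-ascent k u (∈-perms⁻ (suc n) π∈)

fAsc-recurrence : ∀ k′ n i → 2 + i ≤ suc k′ → 2 + i ≤ suc n →
  fAsc (2 + k′) (suc n) (suc i) ≡ fAsc (2 + k′) n i + fAsc (2 + k′) (suc n) (2 + i)
fAsc-recurrence k′ n i 2+i≤k 2+i≤n = begin
  fAsc k (suc n) (suc i)
    ≡⟨ countAvoiding-split-first1 k (suc n) (ascending (suc i)) ⟩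
  first1 (suc i) + notFirst1 (suc i)
    ≡⟨ cong₂ _+_ (countAvoiding-first1 k′ n i) (countAvoiding-next1-or-ascent k n i 2+i≤n) ⟩
  fAsc k n i + (oneAt (suc i) + notFirst1 (2 + i))
    ≡⟨ cong (λ x → fAsc k n i + (x + notFirst1 (2 + i))) oneAt≡first1 ⟩
  fAsc k n i + (first1 (2 + i) + notFirst1 (2 + i))
    ≡⟨ cong (fAsc k n i +_) (countAvoiding-split-first1 k (suc n) (ascending (2 + i))) ⟨
  fAsc k n i + fAsc k (suc n) (2 + i)
    ∎
  where
  open ≡-Reasoning
  k = 2 + k′
  ascending : ℕ → List ℕ → Bool
  ascending j π = ascendingᵇ (take j π)
  oneAt first1 notFirst1 : ℕ → ℕ
  oneAt     j = countAvoiding k (suc n) (λ π → oneAtᵇ j π ∧ ascending j π)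
  first1    j = countAvoiding k (suc n) (λ π → oneAtᵇ 0 π ∧ ascending j π)
  notFirst1 j = countAvoiding k (suc n) (λ π → not (oneAtᵇ 0 π) ∧ ascending j π)
  oneAt≡first1 : oneAt (suc i) ≡ first1 (2 + i)
  oneAt≡first1 = trans (countAvoiding-1at k′ n (suc i) (≤-pred 2+i≤k) (≤-pred 2+i≤n))
                       (sym (countAvoiding-first1 k′ n (suc i)))

-- A₁(n,m) counts avoiders with an ascending prefix

count-subseqs : ∀ m {L} t → AllPairs _<_ L → length t ≡ m →
  (t ⊆ L × count (listEqᵇ t) (subseqs m L) ≡ 1) ⊎ (¬ t ⊆ L × count (listEqᵇ t) (subseqs m L) ≡ 0)
count-subseqs zero    {L}     []      _          _   = inj₁ (minimum L , refl)
count-subseqs (suc m) {[]}    (_ ∷ _) _          _   = inj₂ ((λ ()) , refl)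
count-subseqs (suc m) {x ∷ L} (y ∷ t) (x< ∷ L↑) len
  rewrite count-++ (listEqᵇ (y ∷ t)) (map (x ∷_) (subseqs m L)) (subseqs (suc m) L)
        | count-map (listEqᵇ (y ∷ t)) (x ∷_) (subseqs m L)
  with y ≡ᵇ x in y≡ᵇx
... | false = Data.Sum.map
        (λ (y∷t⊆ , c) → x ∷ʳ y∷t⊆ , cong₂ _+_ (count-false (subseqs m L)) c)
        (λ (y∷t⊈ , c) → (λ { (_ ∷ʳ y∷t⊆) → y∷t⊈ y∷t⊆ ; (refl ∷ _) → subst T y≡ᵇx (≡⇒≡ᵇ y y refl) })
                       , cong₂ _+_ (count-false (subseqs m L)) c)
        (count-subseqs (suc m) (y ∷ t) L↑ len)
... | true with ≡ᵇ⇒≡ y x (subst T (sym y≡ᵇx) _)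
...   | refl with count-subseqs (suc m) (x ∷ t) L↑ len
...     | inj₁ (x∷t⊆ , _) =
          ⊥-elim (All¬⇒¬Any (All.map (λ x<z x≡z → <-irrefl x≡z x<z) x<) (Any-resp-⊆ x∷t⊆ (here refl)))
...     | inj₂ (x∷t⊈ , c₂) = Data.Sum.map
          (λ (t⊆ , c₁) → refl ∷ t⊆ , cong₂ _+_ c₁ c₂)
          (λ (t⊈ , c₁) → (λ { (_ ∷ʳ x∷t⊆) → x∷t⊈ x∷t⊆ ; (refl ∷ t⊆) → t⊈ t⊆ }) , cong₂ _+_ c₁ c₂)
          (count-subseqs m t L↑ (suc-injective len))

A≡fAsc : ∀ k n m → m ≤ n → A k 1 n m ≡ fAsc k n m
A≡fAsc k n m m≤n = begin
  sum (map (fPre k n) S)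
    ≡⟨ sum-map-cong {xs = S} (λ {s} _ → count≡sum (match s) P) ⟩
  sum (map (λ s → sum (map (λ π → indicator (match s π)) P)) S)
    ≡⟨ sum-map-swap (λ s π → indicator (match s π)) S P ⟩
  sum (map (λ π → sum (map (λ s → indicator (match s π)) S)) P)
    ≡⟨ sum-map-cong {xs = P} pointwise ⟩
  sum (map (λ π → indicator (gonAvoidingᵇ k π ∧ ascendingᵇ (take m π))) P)
    ≡⟨ count≡sum _ P ⟨
  fAsc k n m
    ∎
  where
  open ≡-Reasoning
  P = perms n
  S = subseqs m (range 1 n)
  match : List ℕ → List ℕ → Bool
  match s π = gonAvoidingᵇ k π ∧ listEqᵇ (take (length s) π) s
  pointwise : ∀ {π} → π ∈ P →
    sum (map (λ s → indicator (match s π)) S) ≡ indicator (gonAvoidingᵇ k π ∧ ascendingᵇ (take m π))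
  pointwise {π} π∈ = trans
    (sum-map-cong λ {s} s∈ →
      cong (λ l → indicator (gonAvoidingᵇ k π ∧ listEqᵇ (take l π) s)) (proj₂ (∈-subseqs⁻ m _ s∈)))
    (by-avoidance (gonAvoidingᵇ k π))
    where
    perm = ∈-perms⁻ n π∈
    t = take m π
    |t| : length t ≡ m
    |t| = length-take-≤ π (≤-length-perm π∈ m≤n)
    t∈range : All (_∈ range 1 n) t
    t∈range = All.take⁺ m (All.map (λ (1≤x , x≤n) → ∈-range⁺ 1 n 1≤x x≤n) (IsPermutation.entries perm))
    occurrences : count (listEqᵇ t) S ≡ indicator (ascendingᵇ t)
    occurrences with count-subseqs m t (range-ascending 1 n) |t| | ascendingᵇ t in asc
    ... | inj₁ (_   , c) | true  = c
    ... | inj₁ (t⊆ , _) | false =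
      ⊥-elim (subst T asc (AllPairs⇒ascendingᵇ (AllPairs-resp-⊆ t⊆ (range-ascending 1 n))))
    ... | inj₂ (t⊈ , _) | true  =
      ⊥-elim (t⊈ (ascending⇒⊆ (range-ascending 1 n) (ascendingᵇ⇒AllPairs t (subst T (sym asc) _)) t∈range))
    ... | inj₂ (_   , c) | false = c
    by-avoidance : ∀ g → sum (map (λ s → indicator (g ∧ listEqᵇ t s)) S) ≡ indicator (g ∧ ascendingᵇ t)
    by-avoidance false = sum-map-zero S
    by-avoidance true  = trans (sym (count≡sum (listEqᵇ t) S)) occurrences

open import Data.Integer using (+_; _-_)

fAsc≡rhs : ∀ k′ n m → m ≤ suc k′ → m ≤ n → + fAsc (2 + k′) n m ≡ rhs (2 + k′) n m
fAsc≡rhs k′ n       zero          _   _   = trans (cong +_ (fAsc-≤1 _ n 0 z≤n)) (sym (rhs-≤1 _ n 0 z≤n))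
fAsc≡rhs k′ n       (suc zero)    _   _   = trans (cong +_ (fAsc-≤1 _ n 1 ≤-refl)) (sym (rhs-≤1 _ n 1 ≤-refl))
fAsc≡rhs k′ zero    (suc (suc i)) _   ()
fAsc≡rhs k′ (suc n) (suc (suc i)) m≤k m≤n = begin
  + fAsc k (suc n) (2 + i)
    ≡⟨ a≡b+c⇒+c≡+a-+b (fAsc-recurrence k′ n i m≤k m≤n) ⟩
  + fAsc k (suc n) (suc i) - + fAsc k n i
    ≡⟨ cong₂ _-_ (fAsc≡rhs k′ (suc n) (suc i) i+1≤k (≤-trans (n≤1+n _) m≤n))
                 (fAsc≡rhs k′ n i (≤-trans (n≤1+n i) i+1≤k) (<⇒≤ (s≤s⁻¹ m≤n))) ⟩
  rhs k (suc n) (suc i) - rhs k n i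
    ≡⟨ rhs-recurrence k n i ⟨
  rhs k (suc n) (2 + i)
    ∎
  where
  open ≡-Reasoning
  k = 2 + k′
  i+1≤k = ≤-trans (n≤1+n (suc i)) m≤k

lemma2p4 : (k n m : ℕ) → 2 ≤ k → 1 ≤ n → 1 ≤ m → m ≤ (k ∸ 1) ⊓ n →
    + (A k 1 n m) ≡ rhs k n m
lemma2p4 (suc zero)     _ _ (s≤s ()) _ _ _
lemma2p4 (suc (suc k′)) n m _ _ _ m≤ = begin
  + A (2 + k′) 1 n m      ≡⟨ cong +_ (A≡fAsc (2 + k′) n m m≤n) ⟩
  + fAsc (2 + k′) n m     ≡⟨ fAsc≡rhs k′ n m (≤-trans m≤ (m⊓n≤m _ n)) m≤n ⟩
  rhs (2 + k′) n m        ∎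
  where
  open ≡-Reasoning
  m≤n = ≤-trans m≤ (m⊓n≤n _ n)
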